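{- Let $n\ge2$ and let $\mathcal{G}$ be the Sprague–Grundy function of Exco-Nim with parameter $n$. For every position $x=(x_0,x_1,\ldots,x_n)$, $$x_0+\mathcal{G}(0,x_1,\ldots,x_n)\;\le\;\mathcal{G}(x_0,x_1,\ldots,x_n)\;\le\;x_0+x_1+\cdots+x_n.$$
   Context: Exco-Nim with parameter $n\ge2$: positions are tuples $x=(x_0,x_1,\ldots,x_n)$ of nonnegative integers. A legal move $x\to x'$ is to a tuple $x'$ of nonnegative integers with $x'_j\le x_j$ for all $j$, $\sum_j x'_j<\sum_j x_j$, and $x'_i=x_i$ for at least one index $1\le i\le n$. The Sprague–Grundy function is defined recursively by $\mathcal{G}(x)=\operatorname{mex}\{\mathcal{G}(x'): x\to x'\}$, where $\operatorname{mex}(S)$ is the smallest nonnegative integer not in $S$ (so $\mathcal{G}=0$ at terminal positions). -}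

module Defs where

open import Data.Nat using (ℕ; _≤_; _<_)
open import Data.Fin using (Fin; suc)
open import Data.Vec using (Vec; lookup; sum)
open import Data.Product using (Σ; _×_; ∃)
open import Relation.Binary.PropositionalEquality using (_≡_)
open import Relation.Nullary using (¬_)

-- A position of Exco-Nim with parameter n is (x₀, x₁, …, xₙ) : Vec ℕ (suc n);
-- index zero is x₀, index (suc i) is x_{i+1}.
Position : ℕ → Set
Position n = Vec ℕ (Data.Nat.suc n)

Move : (n : ℕ) → Position n → Position n → Set
Move n x x' =
  ((j : Fin (Data.Nat.suc n)) → lookup x' j ≤ lookup x j)
  × (sum x' < sum x)
  × (Σ (Fin n) λ i → lookup x' (suc i) ≡ lookup x (suc i))

IsMex : (ℕ → Set) → ℕ → Set
IsMex S m = ¬ S m × ((k : ℕ) → k < m → S k)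

IsSpragueGrundy : (n : ℕ) → (Position n → ℕ) → Set
IsSpragueGrundy n g =
  (x : Position n) → IsMex (λ v → Σ (Position n) λ x' → Move n x x' × g x' ≡ v) (g x)

module Submission where

-- Both inequalities are instances of two general facts about
-- the Sprague–Grundy function g of an arbitrary game (a move relation on a
-- type of positions):
--   * Rank bound: if some rank function strictly decreases along every move,
--     then g x ≤ rank x.  Otherwise rank x < g x would have to be the value of
--     an option x', but by well-founded induction g x' ≤ rank x' < rank x.
--   * Option dominance: if x → y and every option of y is also an option of x,
--     then g y < g x, since g x must exceed every value 0, …, g y attained
--     among the options of x.
-- For Exco-Nim the total token count  sum x  is such a rank, which gives the
-- upper bound.  For the lower bound, (a ∷ xs) is an option of (suc a ∷ xs)
-- (take one token from heap 0 and keep heap 1 fixed, possible since n ≥ 1),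
-- and each option of (a ∷ xs) is one of (suc a ∷ xs); dominance gives
-- g (a ∷ xs) < g (suc a ∷ xs), and induction on x₀ yields the claim.

open import Defs
open import Data.Nat using (ℕ; zero; suc; _≤_; _<_; _+_; s≤s; _≤?_; _≟_)
open import Data.Nat.Properties
  using (≤-refl; ≤-trans; <-≤-trans; ≤-<-trans; ≤-reflexive; <-irrefl; ≰⇒>; ≤∧≢⇒<; m≤n⇒m≤1+n; n≤1+n; ≤-pred; <⇒≤)
open import Data.Nat.Induction using (<-wellFounded)
open import Data.Vec using (Vec; _∷_; sum; lookup)
open import Data.Fin using (Fin)
open import Data.Product using (Σ; _×_; _,_)
open import Data.Empty using (⊥; ⊥-elim)
open import Induction.WellFounded using (module All)
open import Relation.Binary.Construct.On as On using ()
open import Relation.Binary.PropositionalEquality using (_≡_; refl; sym)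
open import Relation.Nullary using (yes; no)

module Grundy {P : Set} (Move : P → P → Set) (g : P → ℕ)
  (isMex : (x : P) → IsMex (λ v → Σ P λ x' → Move x x' × g x' ≡ v) (g x)) where

  OptionValue : P → ℕ → Set
  OptionValue x v = Σ P λ x' → Move x x' × g x' ≡ v

  belowIsAttained : (x : P) (k : ℕ) → k < g x → OptionValue x k
  belowIsAttained x with isMex x
  ... | _ , below = below

  notAttained : (x : P) → OptionValue x (g x) → ⊥
  notAttained x with isMex x
  ... | notIn , _ = notIn

  rankBound : (rank : P → ℕ) → (∀ x x' → Move x x' → rank x' < rank x) →
              (x : P) → g x ≤ rank x
  rankBound rank decreases =
    All.wfRec (On.wellFounded rank <-wellFounded) _ (λ x → g x ≤ rank x) step
    where
      step : (x : P) → (∀ {x'} → rank x' < rank x → g x' ≤ rank x') → g x ≤ rank x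
      step x ih with g x ≤? rank x
      ... | yes bounded = bounded
      ... | no unbounded with belowIsAttained x (rank x) (≰⇒> unbounded)
      ... | x' , move , gx'≡rank =
        ⊥-elim (<-irrefl refl rank<rank)
        where
          rank'<rank : rank x' < rank x
          rank'<rank = decreases x x' move
          rank<rank : rank x < rank x
          rank<rank =
            ≤-<-trans (≤-trans (≤-reflexive (sym gx'≡rank)) (ih rank'<rank)) rank'<rank

  optionDominance : (x y : P) → Move x y → (∀ z → Move y z → Move x z) → g y < g x
  optionDominance x y x→y inherits with suc (g y) ≤? g x
  ... | yes gy<gx = gy<gx
  ... | no gy≮gx = ⊥-elim (notAttained x (valuesUpTo (g x) (≤-pred (≰⇒> gy≮gx))))
    where
      -- Every value k ≤ g y is attained among the options of x: g y by y
      -- itself, smaller values by options of y, which are options of x.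
      valuesUpTo : (k : ℕ) → k ≤ g y → OptionValue x k
      valuesUpTo k k≤gy with k ≟ g y
      ... | yes refl = y , x→y , refl
      ... | no k≢gy with belowIsAttained y k (≤∧≢⇒< k≤gy k≢gy)
      ... | z , y→z , gz≡k = z , inherits z y→z , gz≡k

moveDecreasesSum : ∀ {n} (x x' : Position n) → Move n x x' → sum x' < sum x
moveDecreasesSum _ _ (_ , fewer , _) = fewer

takeFromHeap₀ : ∀ {n} → 1 ≤ n → (a : ℕ) (xs : Vec ℕ n) → Move n (suc a ∷ xs) (a ∷ xs)
takeFromHeap₀ {suc _} _ a xs = heapsShrink , ≤-refl , Fin.zero , refl
  where
    heapsShrink : ∀ j → lookup (a ∷ xs) j ≤ lookup (suc a ∷ xs) j
    heapsShrink Fin.zero = n≤1+n a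
    heapsShrink (Fin.suc j) = ≤-refl

optionsGrowWithHeap₀ : ∀ {n} (a : ℕ) (xs : Vec ℕ n) (z : Position n) →
                       Move n (a ∷ xs) z → Move n (suc a ∷ xs) z
optionsGrowWithHeap₀ a xs z (heapsShrink , fewer , fixedHeap) =
  heapsShrink' , m≤n⇒m≤1+n fewer , fixedHeap
  where
    heapsShrink' : ∀ j → lookup z j ≤ lookup (suc a ∷ xs) j
    heapsShrink' Fin.zero = m≤n⇒m≤1+n (heapsShrink Fin.zero)
    heapsShrink' (Fin.suc j) = heapsShrink (Fin.suc j)

-- Lower bound: each token on heap 0 raises the Grundy value by at least one.
heap₀LowerBound : (n : ℕ) → 1 ≤ n → (g : Position n → ℕ) → IsSpragueGrundy n g →
                  (a : ℕ) (xs : Vec ℕ n) → a + g (0 ∷ xs) ≤ g (a ∷ xs)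
heap₀LowerBound n _ g sg zero xs = ≤-refl
heap₀LowerBound n n≥1 g sg (suc a) xs =
  <-≤-trans (s≤s (heap₀LowerBound n n≥1 g sg a xs))
            (optionDominance (suc a ∷ xs) (a ∷ xs) (takeFromHeap₀ n≥1 a xs) (optionsGrowWithHeap₀ a xs))
  where open Grundy (Move n) g sg

proposition2p2 : (n : ℕ) → 2 ≤ n → (g : Position n → ℕ) → IsSpragueGrundy n g →
    (x₀ : ℕ) (xs : Vec ℕ n) →
      (x₀ + g (0 ∷ xs) ≤ g (x₀ ∷ xs)) × (g (x₀ ∷ xs) ≤ sum (x₀ ∷ xs))
proposition2p2 n n≥2 g sg x₀ xs =
  heap₀LowerBound n (<⇒≤ n≥2) g sg x₀ xs ,
  rankBound sum moveDecreasesSum (x₀ ∷ xs)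
  where open Grundy (Move n) g sg
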